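{- Let $G$ be a finite group and $H$ a normal subgroup of $G$. (a) If either $|H|$ or $|G/H|$ is odd, then $H$ is a perfect code of $G$. (b) If $|H|$ is even and $|G/H|$ is odd, then $H$ is a total perfect code of $G$.
   Context: All groups and graphs are finite; $e$ denotes the identity of $G$. For $S\subseteq G$ with $e\notin S$ and $S^{ -1}=S$, the Cayley graph $\mathrm{Cay}(G,S)$ has vertex set $G$, with $x,y$ adjacent iff $yx^{ -1}\in S$. A subset $C$ of the vertex set of a graph is a perfect code if every vertex is at distance at most one from exactly one vertex of $C$; it is a total perfect code if every vertex has exactly one neighbour in $C$. A subset $C\subseteq G$ is called a perfect code (resp. total perfect code) of $G$ if it is a perfect code (resp. total perfect code) in some Cayley graph $\mathrm{Cay}(G,S)$ of $G$. -}

module Defs where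

open import Data.Nat using (ℕ; _*_)
open import Data.Nat.Divisibility using (_∣_)
open import Data.Fin using (Fin)
open import Data.Fin.Subset using (Subset; _∈_; _∉_; ∣_∣)
open import Data.Product using (Σ; _×_; ∃)
open import Data.Sum using (_⊎_)
open import Relation.Nullary using (¬_)
open import Relation.Binary.PropositionalEquality using (_≡_)
open import Algebra.Structures using (IsGroup)

-- A finite group, presented (up to isomorphism) on the carrier Fin order,
-- with propositional equality.
record FiniteGroup : Set where
  field
    order : ℕ
    _∙_   : Fin order → Fin order → Fin order
    e     : Fin order
    _⁻¹   : Fin order → Fin order
    isGroup : IsGroup _≡_ _∙_ e _⁻¹
  infixl 7 _∙_
  infix 8 _⁻¹

Odd : ℕ → Set
Odd m = ¬ (2 ∣ m)

Even : ℕ → Set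
Even m = 2 ∣ m

module _ (G : FiniteGroup) where
  open FiniteGroup G

  Sub : Set
  Sub = Subset order

  IsSubgroup : Sub → Set
  IsSubgroup H = (e ∈ H)
               × (∀ x y → x ∈ H → y ∈ H → (x ∙ y) ∈ H)
               × (∀ x → x ∈ H → (x ⁻¹) ∈ H)

  IsNormalSubgroup : Sub → Set
  IsNormalSubgroup H = IsSubgroup H × (∀ g h → h ∈ H → (g ∙ h ∙ g ⁻¹) ∈ H)

  -- |G/H| = k  (the quotient G/H has k elements; by Lagrange, k * |H| = |G|,
  -- and this determines k since |H| ≥ 1)
  QuotientOrder : Sub → ℕ → Set
  QuotientOrder H k = k * ∣ H ∣ ≡ order

  IsConnectionSet : Sub → Set
  IsConnectionSet S = (e ∉ S) × (∀ x → x ∈ S → (x ⁻¹) ∈ S)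

  Adj : Sub → Fin order → Fin order → Set
  Adj S x y = (y ∙ x ⁻¹) ∈ S

  ExactlyOne : Sub → (Fin order → Fin order → Set) → Fin order → Set
  ExactlyOne C R x = Σ (Fin order) (λ c → c ∈ C × R x c)
                   × (∀ c c′ → c ∈ C → R x c → c′ ∈ C → R x c′ → c ≡ c′)

  IsPerfectCodeIn : Sub → Sub → Set
  IsPerfectCodeIn S C = ∀ x → ExactlyOne C (λ x c → x ≡ c ⊎ Adj S x c) x

  IsTotalPerfectCodeIn : Sub → Sub → Set
  IsTotalPerfectCodeIn S C = ∀ x → ExactlyOne C (Adj S) x

  IsPerfectCode : Sub → Set
  IsPerfectCode C = Σ Sub (λ S → IsConnectionSet S × IsPerfectCodeIn S C)

  IsTotalPerfectCode : Sub → Set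
  IsTotalPerfectCode C = Σ Sub (λ S → IsConnectionSet S × IsTotalPerfectCodeIn S C)

-- If T ⊆ G is inverse-closed and meets every coset of H exactly once, then H is a total perfect
-- code in Cay(G, T) and, when e ∈ T, a perfect code in Cay(G, T ∖ {e}). Such a T, meeting H in a
-- prescribed c = c ⁻¹, exists as soon as every coset Hx ≠ H with x² ∈ H contains an involution:
-- pair each coset with its inverse coset, take t and t ⁻¹ as representatives, and an involution in
-- a self-inverse coset. If ∣H∣ is odd, a ↦ x⁻¹a⁻¹x⁻¹ is an involution of H whose fixed points a
-- give involutions ax. If ∣G/H∣ is odd there is no such coset, since H ∪ Hx would be a subgroup of
-- order 2∣H∣. For (b), an even ∣H∣ supplies an involution c ∈ H, and then e ∉ T.

module Submission where

open import Defs
open import Algebra.Bundles using (Group)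
open import Data.Bool using (true; false; if_then_else_)
open import Data.Fin using (Fin; zero; suc; _≟_; _≤_)
open import Data.Fin.Permutation using (Permutation′; _⟨$⟩ʳ_; permutation)
open import Data.Fin.Properties using (any?; all?; ≤-antisym; _≤?_)
open import Data.Fin.Subset
open import Data.Fin.Subset.Properties
open import Data.Nat as ℕ using (ℕ; _+_; _*_; _<_; z≤n; s≤s; >-nonZero)
open import Data.Nat.Divisibility using (_∣_; _∣0; ∣m∣n⇒∣m+n; ∣m+n∣m⇒∣n; ∣1⇒≡1; ∣-refl; *-cancelʳ-∣)
open import Data.Nat.Induction using (<-wellFounded)
open import Data.Nat.Properties using (+-suc; +-comm; +-identityʳ; +-0-commutativeMonoid)
open import Algebra.Properties.CommutativeMonoid.Sum +-0-commutativeMonoid using (sum; sum-permute)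
open import Data.Product using (∃; _×_; _,_; proj₁; proj₂)
open import Data.Sum using (_⊎_; inj₁; inj₂; [_,_]′; map₂)
open import Data.Vec using ([]; _∷_; here; there; tabulate)
open import Data.Vec.Properties using (lookup∘tabulate; []=⇒lookup; lookup⇒[]=)
open import Function using (_∘_)
open import Induction.WellFounded using (Acc; acc)
open import Level using (0ℓ)
open import Relation.Binary using (IsEquivalence)
open import Relation.Binary.PropositionalEquality hiding ([_])
open import Relation.Nullary using (Dec; does; yes; no; contradiction; _×-dec_; _⊎-dec_; _→-dec_)
open import Relation.Nullary.Decidable using (dec-true)

private
  variable
    n : ℕ

∣p∣≡∣p∩q∣+∣p─q∣ : ∀ (p q : Subset n) → ∣ p ∣ ≡ ∣ p ∩ q ∣ + ∣ p ─ q ∣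
∣p∣≡∣p∩q∣+∣p─q∣ []            []            = refl
∣p∣≡∣p∩q∣+∣p─q∣ (outside ∷ p) (inside  ∷ q) = ∣p∣≡∣p∩q∣+∣p─q∣ p q
∣p∣≡∣p∩q∣+∣p─q∣ (outside ∷ p) (outside ∷ q) = ∣p∣≡∣p∩q∣+∣p─q∣ p q
∣p∣≡∣p∩q∣+∣p─q∣ (inside  ∷ p) (inside  ∷ q) = cong ℕ.suc (∣p∣≡∣p∩q∣+∣p─q∣ p q)
∣p∣≡∣p∩q∣+∣p─q∣ (inside  ∷ p) (outside ∷ q) =
  trans (cong ℕ.suc (∣p∣≡∣p∩q∣+∣p─q∣ p q)) (sym (+-suc ∣ p ∩ q ∣ ∣ p ─ q ∣))

x∈p─q⇒x∉q : ∀ {x : Fin n} (p q : Subset n) → x ∈ p ─ q → x ∉ q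
x∈p─q⇒x∉q (_ ∷ p) (inside ∷ q) ()           here
x∈p─q⇒x∉q (_ ∷ p) (_      ∷ q) (there x∈p─q) (there x∈q) = x∈p─q⇒x∉q p q x∈p─q x∈q

q⊆p⇒p∩q≡q : ∀ {p q : Subset n} → q ⊆ p → p ∩ q ≡ q
q⊆p⇒p∩q≡q {p = p} {q} q⊆p = ⊆-antisym (p∩q⊆q p q) (λ x∈q → x∈p∩q⁺ (q⊆p x∈q , x∈q))

x∈p⇒∣p∣≡1+∣p-x∣ : ∀ {x : Fin n} {p} → x ∈ p → ∣ p ∣ ≡ ℕ.suc ∣ p - x ∣
x∈p⇒∣p∣≡1+∣p-x∣ {x = x} {p} x∈p = begin
  ∣ p ∣                     ≡⟨ ∣p∣≡∣p∩q∣+∣p─q∣ p ⁅ x ⁆ ⟩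
  ∣ p ∩ ⁅ x ⁆ ∣ + ∣ p - x ∣ ≡⟨ cong (λ q → ∣ q ∣ + ∣ p - x ∣) (q⊆p⇒p∩q≡q ⁅x⁆⊆p) ⟩
  ∣ ⁅ x ⁆ ∣ + ∣ p - x ∣     ≡⟨ cong (_+ ∣ p - x ∣) (∣⁅x⁆∣≡1 x) ⟩
  ℕ.suc ∣ p - x ∣           ∎
  where
  open ≡-Reasoning
  ⁅x⁆⊆p : ⁅ x ⁆ ⊆ p
  ⁅x⁆⊆p y∈⁅x⁆ = subst (_∈ p) (sym (x∈⁅y⁆⇒x≡y x y∈⁅x⁆)) x∈p

subsetOf : {P : Fin n → Set} → (∀ x → Dec (P x)) → Subset n
subsetOf P? = tabulate (does ∘ P?)

∈-subsetOf⁺ : ∀ {P : Fin n → Set} (P? : ∀ x → Dec (P x)) {x} → P x → x ∈ subsetOf P?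
∈-subsetOf⁺ P? {x} px = lookup⇒[]= x _ (trans (lookup∘tabulate (does ∘ P?) x) (dec-true (P? x) px))

∈-subsetOf⁻ : ∀ {P : Fin n → Set} (P? : ∀ x → Dec (P x)) {x} → x ∈ subsetOf P? → P x
∈-subsetOf⁻ P? {x} x∈ with P? x | trans (sym (lookup∘tabulate (does ∘ P?) x)) ([]=⇒lookup x∈)
... | yes px | _ = px

subsetOf-∈?≡p : ∀ (p : Subset n) → subsetOf (_∈? p) ≡ p
subsetOf-∈?≡p p = ⊆-antisym (∈-subsetOf⁻ (_∈? p)) (∈-subsetOf⁺ (_∈? p))

doubleton? : ∀ (x y z : Fin n) → Dec (x ≡ z ⊎ y ≡ z)
doubleton? x y z = (x ≟ z) ⊎-dec (y ≟ z)

doubleton : Fin n → Fin n → Subset n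
doubleton x y = subsetOf (doubleton? x y)

∣doubleton∣≡2 : ∀ {x y : Fin n} → x ≢ y → ∣ doubleton x y ∣ ≡ 2
∣doubleton∣≡2 {x = x} {y} x≢y = begin
  ∣ doubleton x y ∣             ≡⟨ x∈p⇒∣p∣≡1+∣p-x∣ (∈-subsetOf⁺ (doubleton? x y) (inj₁ refl)) ⟩
  ℕ.suc ∣ doubleton x y - x ∣   ≡⟨ cong (λ p → ℕ.suc ∣ p ∣) doubleton-x≡⁅y⁆ ⟩
  ℕ.suc ∣ ⁅ y ⁆ ∣               ≡⟨ cong ℕ.suc (∣⁅x⁆∣≡1 y) ⟩
  2                             ∎
  where
  open ≡-Reasoning
  doubleton-x≡⁅y⁆ : doubleton x y - x ≡ ⁅ y ⁆
  doubleton-x≡⁅y⁆ = ⊆-antisym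
    (λ z∈ → [ (λ x≡z → contradiction (subst (_∈ ⁅ x ⁆) x≡z (x∈⁅x⁆ x)) (x∈p─q⇒x∉q _ _ z∈))
            , (λ y≡z → subst (_∈ ⁅ y ⁆) y≡z (x∈⁅x⁆ y)) ]′
            (∈-subsetOf⁻ (doubleton? x y) (p─q⊆p _ _ z∈)))
    (λ z∈⁅y⁆ → subst (_∈ doubleton x y - x) (sym (x∈⁅y⁆⇒x≡y y z∈⁅y⁆))
                 (x∈p∧x≢y⇒x∈p-y (∈-subsetOf⁺ (doubleton? x y) (inj₂ refl)) (x≢y ∘ sym)))

∣subsetOf∣≡∑ : ∀ {P : Fin n → Set} (P? : ∀ x → Dec (P x)) →
               ∣ subsetOf P? ∣ ≡ sum (λ i → if does (P? i) then 1 else 0)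
∣subsetOf∣≡∑ {n = ℕ.zero}  P? = refl
∣subsetOf∣≡∑ {n = ℕ.suc n} P? with does (P? zero)
... | true  = cong ℕ.suc (∣subsetOf∣≡∑ (P? ∘ suc))
... | false = ∣subsetOf∣≡∑ (P? ∘ suc)

preimage : (Fin n → Fin n) → Subset n → Subset n
preimage f p = subsetOf (λ x → f x ∈? p)

∣preimage∣≡∣p∣ : ∀ (π : Permutation′ n) p → ∣ preimage (π ⟨$⟩ʳ_) p ∣ ≡ ∣ p ∣
∣preimage∣≡∣p∣ π p = begin
  ∣ preimage (π ⟨$⟩ʳ_) p ∣       ≡⟨ ∣subsetOf∣≡∑ (λ x → π ⟨$⟩ʳ x ∈? p) ⟩
  sum (indicator ∘ (π ⟨$⟩ʳ_))    ≡⟨ sum-permute indicator π ⟨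
  sum indicator                  ≡⟨ ∣subsetOf∣≡∑ (_∈? p) ⟨
  ∣ subsetOf (_∈? p) ∣           ≡⟨ cong ∣_∣ (subsetOf-∈?≡p p) ⟩
  ∣ p ∣                          ∎
  where
  open ≡-Reasoning
  indicator : Fin _ → ℕ
  indicator x = if does (x ∈? p) then 1 else 0

module _ {_~_ : Fin n → Fin n → Set} (~-isEquivalence : IsEquivalence _~_) (_~?_ : ∀ x y → Dec (x ~ y)) where

  open IsEquivalence ~-isEquivalence renaming (refl to ~-refl; sym to ~-sym; trans to ~-trans)

  ∣class∣≡m⇒m∣∣p∣ : ∀ m (p : Subset n) →
                    (∀ {x y} → x ∈ p → x ~ y → y ∈ p) →
                    (∀ {x} → x ∈ p → ∣ subsetOf (x ~?_) ∣ ≡ m) →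
                    m ∣ ∣ p ∣
  ∣class∣≡m⇒m∣∣p∣ m p = go p (<-wellFounded ∣ p ∣)
    where
    [_] : Fin n → Subset n
    [ x ] = subsetOf (x ~?_)

    go : ∀ p → Acc _<_ ∣ p ∣ →
         (∀ {x y} → x ∈ p → x ~ y → y ∈ p) → (∀ {x} → x ∈ p → ∣ [ x ] ∣ ≡ m) → m ∣ ∣ p ∣
    go p (acc rec) closed size with nonempty? p
    ... | no p-empty =
      subst (λ q → m ∣ ∣ q ∣) (sym (Empty-unique p-empty)) (subst (m ∣_) (sym (∣⊥∣≡0 n)) (m ∣0))
    ... | yes (x , x∈p) = subst (m ∣_) (sym ∣p∣≡m+∣p─[x]∣)
      (∣m∣n⇒∣m+n ∣-refl (go (p ─ [ x ]) (rec smaller) closed′ (size ∘ p─q⊆p p [ x ])))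
      where
      [x]⊆p : [ x ] ⊆ p
      [x]⊆p = closed x∈p ∘ ∈-subsetOf⁻ (x ~?_)
      ∣p∣≡m+∣p─[x]∣ : ∣ p ∣ ≡ m + ∣ p ─ [ x ] ∣
      ∣p∣≡m+∣p─[x]∣ = trans (∣p∣≡∣p∩q∣+∣p─q∣ p [ x ])
        (cong (_+ ∣ p ─ [ x ] ∣) (trans (cong ∣_∣ (q⊆p⇒p∩q≡q [x]⊆p)) (size x∈p)))
      smaller : ∣ p ─ [ x ] ∣ < ∣ p ∣
      smaller = p∩q≢∅⇒∣p─q∣<∣p∣ p [ x ] (x , x∈p∩q⁺ (x∈p , ∈-subsetOf⁺ (x ~?_) ~-refl))
      closed′ : ∀ {y z} → y ∈ p ─ [ x ] → y ~ z → z ∈ p ─ [ x ]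
      closed′ y∈p─[x] y~z = x∈p∧x∉q⇒x∈p─q (closed (p─q⊆p p [ x ] y∈p─[x]) y~z) λ z∈[x] →
        x∈p─q⇒x∉q p [ x ] y∈p─[x] (∈-subsetOf⁺ (x ~?_) (~-trans (∈-subsetOf⁻ (x ~?_) z∈[x]) (~-sym y~z)))

module _ {f : Fin n → Fin n} (f-involutive : ∀ x → f (f x) ≡ x) where

  private
    _~_ : Fin n → Fin n → Set
    x ~ y = x ≡ y ⊎ f x ≡ y

    _~?_ : ∀ x y → Dec (x ~ y)
    x ~? y = doubleton? x (f x) y

    fy≡x : ∀ {x y} → f x ≡ y → f y ≡ x
    fy≡x {x} refl = f-involutive x

    ~-isEquivalence : IsEquivalence _~_
    ~-isEquivalence = record
      { refl  = inj₁ refl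
      ; sym   = λ { (inj₁ refl) → inj₁ refl ; (inj₂ fx≡y) → inj₂ (fy≡x fx≡y) }
      ; trans = λ { (inj₁ refl) y~z → y~z
                  ; (inj₂ fx≡y) (inj₁ refl) → inj₂ fx≡y
                  ; (inj₂ fx≡y) (inj₂ fy≡z) → inj₁ (trans (sym (fy≡x fx≡y)) fy≡z) }
      }

  odd⇒fixedPoint : ∀ (p : Subset n) → (∀ {x} → x ∈ p → f x ∈ p) → Odd ∣ p ∣ →
                   ∃ λ x → x ∈ p × f x ≡ x
  odd⇒fixedPoint p f-closed odd with any? (λ x → x ∈? p ×-dec f x ≟ x)
  ... | yes fixedPoint   = fixedPoint
  ... | no  noFixedPoint =
    contradiction (∣class∣≡m⇒m∣∣p∣ ~-isEquivalence _~?_ 2 p closed size) odd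
    where
    closed : ∀ {x y} → x ∈ p → x ~ y → y ∈ p
    closed x∈p (inj₁ refl) = x∈p
    closed x∈p (inj₂ refl) = f-closed x∈p
    size : ∀ {x} → x ∈ p → ∣ doubleton x (f x) ∣ ≡ 2
    size {x} x∈p = ∣doubleton∣≡2 (λ x≡fx → noFixedPoint (x , x∈p , sym x≡fx))

Least : (Fin n → Set) → Fin n → Set
Least P m = P m × (∀ z → P z → m ≤ z)

least : ∀ {P : Fin n → Set} → (∀ x → Dec (P x)) → ∃ P → ∃ (Least P)
least {n = ℕ.zero}  P? (() , _)
least {n = ℕ.suc n} P? (x , px) with P? zero
... | yes p₀ = zero , p₀ , λ _ _ → z≤n
... | no ¬p₀ with x
...   | zero   = contradiction px ¬p₀
...   | suc x′ with least (P? ∘ suc) (x′ , px)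
...     | m , pm , m-min = suc m , pm , λ { zero p → contradiction p ¬p₀ ; (suc z) p → s≤s (m-min z p) }

Least-unique : ∀ {P : Fin n → Set} {m m′} → Least P m → Least P m′ → m ≡ m′
Least-unique (pm , m-min) (pm′ , m′-min) = ≤-antisym (m-min _ pm′) (m′-min _ pm)

Least-cong : ∀ {P Q : Fin n → Set} {m} → (∀ {z} → P z → Q z) → (∀ {z} → Q z → P z) → Least P m → Least Q m
Least-cong P⇒Q Q⇒P (pm , m-min) = P⇒Q pm , λ z qz → m-min z (Q⇒P qz)

module _ {_~_ : Fin n → Fin n → Set} (~-isEquivalence : IsEquivalence _~_) (_~?_ : ∀ x y → Dec (x ~ y))
         {ι : Fin n → Fin n} (ι-involutive : ∀ x → ι (ι x) ≡ x) (ι-cong : ∀ {x y} → x ~ y → ι x ~ ι y)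
         {Admissible : Fin n → Set} (Admissible? : ∀ x → Dec (Admissible x))
         where

  open IsEquivalence ~-isEquivalence renaming (refl to ~-refl; sym to ~-sym; trans to ~-trans)

  record SymmetricTransversal : Set where
    field
      T          : Subset n
      ι-closed   : ∀ {t} → t ∈ T → ι t ∈ T
      meets      : ∀ x → ∃ λ t → t ∈ T × x ~ t
      unique     : ∀ {t t′} → t ∈ T → t′ ∈ T → t ~ t′ → t ≡ t′
      admissible : ∀ {t} → t ∈ T → t ~ ι t → Admissible t

  private
    Stable : Fin n → Set
    Stable x = x ~ ι x

    ι-swap : ∀ {x y} → ι x ~ y → x ~ ι y
    ι-swap {x} ιx~y = subst (_~ _) (ι-involutive x) (ι-cong ιx~y)

    _≈_ : Fin n → Fin n → Set
    x ≈ y = x ~ y ⊎ ι x ~ y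

    ≈-sym : ∀ {x y} → x ≈ y → y ≈ x
    ≈-sym (inj₁ x~y)  = inj₁ (~-sym x~y)
    ≈-sym (inj₂ ιx~y) = inj₂ (~-sym (ι-swap ιx~y))

    ≈-trans : ∀ {x y z} → x ≈ y → y ≈ z → x ≈ z
    ≈-trans (inj₁ x~y)  (inj₁ y~z)  = inj₁ (~-trans x~y y~z)
    ≈-trans (inj₁ x~y)  (inj₂ ιy~z) = inj₂ (~-trans (ι-cong x~y) ιy~z)
    ≈-trans (inj₂ ιx~y) (inj₁ y~z)  = inj₂ (~-trans ιx~y y~z)
    ≈-trans (inj₂ ιx~y) (inj₂ ιy~z) = inj₁ (~-trans (ι-swap ιx~y) ιy~z)

    x≈ιx : ∀ x → x ≈ ι x
    x≈ιx x = inj₂ ~-refl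

    Candidate : Fin n → Set
    Candidate z = Stable z → Admissible z × ι z ≡ z

    Chosen : Fin n → Fin n → Set
    Chosen x z = x ≈ z × Candidate z

    Chosen? : ∀ x z → Dec (Chosen x z)
    Chosen? x z = ((x ~? z) ⊎-dec (ι x ~? z)) ×-dec ((z ~? ι z) →-dec (Admissible? z ×-dec (ι z ≟ z)))

    Least-Chosen-cong : ∀ {x y m} → x ≈ y → Least (Chosen x) m → Least (Chosen y) m
    Least-Chosen-cong x≈y = Least-cong (λ (x≈z , cz) → ≈-trans (≈-sym x≈y) x≈z , cz)
                                       (λ (y≈z , cz) → ≈-trans x≈y y≈z , cz)

    -- T takes from each class together with its mirror image the least candidate m and ι m;
    -- in a stable class the candidates are admissible fixed points of ι, so there m = ι m.
    Member : Fin n → Set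
    Member t = Least (Chosen t) t ⊎ Least (Chosen t) (ι t)

    Member? : ∀ t → Dec (Member t)
    Member? t = Least? t ⊎-dec Least? (ι t)
      where
      Least? : ∀ m → Dec (Least (Chosen t) m)
      Least? m = Chosen? t m ×-dec all? (λ z → Chosen? t z →-dec (m ≤? z))

    ι-injective : ∀ {x y} → ι x ≡ ι y → x ≡ y
    ι-injective {x} {y} ιx≡ιy = trans (sym (ι-involutive x)) (trans (cong ι ιx≡ιy) (ι-involutive y))

    Member-ι : ∀ {t} → Member t → Member (ι t)
    Member-ι {t} (inj₁ t-least)  =
      inj₂ (subst (Least (Chosen (ι t))) (sym (ι-involutive t)) (Least-Chosen-cong (x≈ιx t) t-least))
    Member-ι {t} (inj₂ ιt-least) = inj₁ (Least-Chosen-cong (x≈ιx t) ιt-least)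

    Member-mixed : ∀ {t t′} → Least (Chosen t) t → Least (Chosen t) (ι t′) → t ~ t′ → t ≡ t′
    Member-mixed {t} {t′} t-least ιt′-least t~t′ = trans (sym ιt≡t) ιt≡t′
      where
      ιt≡t′ : ι t ≡ t′
      ιt≡t′ = trans (cong ι (Least-unique t-least ιt′-least)) (ι-involutive t′)
      ιt≡t : ι t ≡ t
      ιt≡t = proj₂ (proj₂ (proj₁ t-least) (subst (t ~_) (sym ιt≡t′) t~t′))

    Member-unique : ∀ {t t′} → Member t → Member t′ → t ~ t′ → t ≡ t′
    Member-unique (inj₁ l) (inj₁ l′) t~t′ = Least-unique l (Least-Chosen-cong (inj₁ (~-sym t~t′)) l′)
    Member-unique (inj₂ l) (inj₂ l′) t~t′ = ι-injective (Least-unique l (Least-Chosen-cong (inj₁ (~-sym t~t′)) l′))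
    Member-unique (inj₁ l) (inj₂ l′) t~t′ = Member-mixed l (Least-Chosen-cong (inj₁ (~-sym t~t′)) l′) t~t′
    Member-unique (inj₂ l) (inj₁ l′) t~t′ = sym (Member-mixed l′ (Least-Chosen-cong (inj₁ t~t′) l) (~-sym t~t′))

    Member-admissible : ∀ {t} → Member t → Stable t → Admissible t
    Member-admissible (inj₁ t-least) stable = proj₁ (proj₂ (proj₁ t-least) stable)
    Member-admissible {t} (inj₂ ιt-least) stable = subst Admissible ιt≡t admissibleιt
      where
      ιt-fixed : Admissible (ι t) × ι (ι t) ≡ ι t
      ιt-fixed = proj₂ (proj₁ ιt-least) (ι-cong stable)
      admissibleιt : Admissible (ι t)
      admissibleιt = proj₁ ιt-fixed
      ιt≡t : ι t ≡ t
      ιt≡t = trans (sym (proj₂ ιt-fixed)) (ι-involutive t)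

  symmetricTransversal : (∀ x → x ~ ι x → ∃ λ y → x ~ y × Admissible y × ι y ≡ y) → SymmetricTransversal
  symmetricTransversal fixedPoints = record
    { T          = subsetOf Member?
    ; ι-closed   = ∈-subsetOf⁺ Member? ∘ Member-ι ∘ ∈-subsetOf⁻ Member?
    ; meets      = meets
    ; unique     = λ t∈T t′∈T → Member-unique (∈-subsetOf⁻ Member? t∈T) (∈-subsetOf⁻ Member? t′∈T)
    ; admissible = Member-admissible ∘ ∈-subsetOf⁻ Member?
    }
    where
    chosen : ∀ x → ∃ (Chosen x)
    chosen x with x ~? ι x
    ... | yes stable = let y , x~y , admissibleʸ , ιy≡y = fixedPoints x stable
                       in y , inj₁ x~y , λ _ → admissibleʸ , ιy≡y
    ... | no ¬stable = x , inj₁ ~-refl , λ stable → contradiction stable ¬stable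

    meets : ∀ x → ∃ λ t → t ∈ subsetOf Member? × x ~ t
    meets x with least (Chosen? x) (chosen x)
    ... | m , m-least with proj₁ (proj₁ m-least)
    ...   | inj₁ x~m  = m , ∈-subsetOf⁺ Member? (inj₁ (Least-Chosen-cong (inj₁ x~m) m-least)) , x~m
    ...   | inj₂ ιx~m = ι m , ∈-subsetOf⁺ Member? (inj₂ ιιm-least) , ι-swap ιx~m
      where
      ιιm-least : Least (Chosen (ι m)) (ι (ι m))
      ιιm-least = subst (Least (Chosen (ι m))) (sym (ι-involutive m)) (Least-Chosen-cong (inj₁ (ι-swap ιx~m)) m-least)

even-suc⇒odd : ∀ {m} → Even (ℕ.suc m) → Odd m
even-suc⇒odd {m} 2∣1+m 2∣m = contradiction (∣1⇒≡1 (∣m+n∣m⇒∣n (subst (2 ∣_) (+-comm 1 m) 2∣1+m) 2∣m)) λ ()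

module _ (G : FiniteGroup) where

  open FiniteGroup G

  private
    group : Group 0ℓ 0ℓ
    group = record { isGroup = isGroup }

  open Group group using (assoc; identityˡ; identityʳ; inverseˡ; inverseʳ)
  open import Algebra.Properties.Group group
    using (⁻¹-involutive; ⁻¹-anti-homo-∙; ε⁻¹≈ε; x∙y⁻¹≈ε⇒x≈y; \\-leftDividesˡ; \\-leftDividesʳ; //-rightDividesˡ; //-rightDividesʳ)

  rightTranslation : Fin order → Permutation′ order
  rightTranslation g = permutation (_∙ g) (_∙ g ⁻¹) (//-rightDividesˡ g) (//-rightDividesʳ g)

  x⁻¹≡e⇒x≡e : ∀ {x} → x ⁻¹ ≡ e → x ≡ e
  x⁻¹≡e⇒x≡e {x} x⁻¹≡e = trans (sym (⁻¹-involutive x)) (trans (cong _⁻¹ x⁻¹≡e) ε⁻¹≈ε)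

  inverseClosed⇒isConnectionSet : ∀ {T : Sub G} → (∀ {t} → t ∈ T → t ⁻¹ ∈ T) → IsConnectionSet G (T - e)
  inverseClosed⇒isConnectionSet {T} T-closed = e∉T-e , λ t t∈T-e →
    x∈p∧x≢y⇒x∈p-y (T-closed (p─q⊆p T ⁅ e ⁆ t∈T-e)) (≢e t∈T-e ∘ x⁻¹≡e⇒x≡e)
    where
    ≢e : ∀ {t} → t ∈ T - e → t ≢ e
    ≢e t∈T-e = x∉⁅y⁆⇒x≢y (x∈p─q⇒x∉q T ⁅ e ⁆ t∈T-e)
    e∉T-e : e ∉ T - e
    e∉T-e e∈T-e = ≢e e∈T-e refl

  -- c ↦ c ∙ y matches the C-neighbours of y ⁻¹ in Cay(G, S) with the S-neighbours of y in Cay(G, C).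
  totalPerfectCode-swap : ∀ {S C : Sub G} → IsTotalPerfectCodeIn G S C → IsTotalPerfectCodeIn G C S
  totalPerfectCode-swap {S} {C} C-code y =
    let (c , c∈C , c∙y⁻¹⁻¹∈S) , unique = C-code (y ⁻¹)
    in (c ∙ y , subst (_∈ S) (cong (c ∙_) (⁻¹-involutive y)) c∙y⁻¹⁻¹∈S , subst (_∈ C) (sym (//-rightDividesʳ y c)) c∈C)
     , λ s s′ s∈S s∙y⁻¹∈C s′∈S s′∙y⁻¹∈C →
         ∙y⁻¹-injective (unique (s ∙ y ⁻¹) (s′ ∙ y ⁻¹) s∙y⁻¹∈C (back s∈S) s′∙y⁻¹∈C (back s′∈S))
    where
    back : ∀ {s} → s ∈ S → s ∙ y ⁻¹ ∙ y ⁻¹ ⁻¹ ∈ S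
    back {s} = subst (_∈ S) (sym (//-rightDividesʳ (y ⁻¹) s))
    ∙y⁻¹-injective : ∀ {s s′} → s ∙ y ⁻¹ ≡ s′ ∙ y ⁻¹ → s ≡ s′
    ∙y⁻¹-injective {s} {s′} eq = trans (sym (//-rightDividesˡ y s)) (trans (cong (_∙ y) eq) (//-rightDividesˡ y s′))

  totalPerfectCode⇒perfectCode : ∀ {T C : Sub G} → e ∈ T → IsTotalPerfectCodeIn G T C → IsPerfectCodeIn G (T - e) C
  totalPerfectCode⇒perfectCode {T} {C} e∈T C-code x =
    let (c , c∈C , c∙x⁻¹∈T) , unique = C-code x
    in (c , c∈C , to c∙x⁻¹∈T) , λ c c′ c∈C r c′∈C r′ → unique c c′ c∈C (from r) c′∈C (from r′)
    where
    to : ∀ {c} → c ∙ x ⁻¹ ∈ T → x ≡ c ⊎ c ∙ x ⁻¹ ∈ T - e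
    to {c} c∙x⁻¹∈T with c ∙ x ⁻¹ ≟ e
    ... | yes c∙x⁻¹≡e = inj₁ (sym (x∙y⁻¹≈ε⇒x≈y c x c∙x⁻¹≡e))
    ... | no  c∙x⁻¹≢e = inj₂ (x∈p∧x≢y⇒x∈p-y c∙x⁻¹∈T c∙x⁻¹≢e)
    from : ∀ {c} → x ≡ c ⊎ c ∙ x ⁻¹ ∈ T - e → c ∙ x ⁻¹ ∈ T
    from (inj₁ refl)        = subst (_∈ T) (sym (inverseʳ x)) e∈T
    from (inj₂ c∙x⁻¹∈T-e)  = p─q⊆p T ⁅ e ⁆ c∙x⁻¹∈T-e

  module _ {K : Sub G} (K-subgroup : IsSubgroup G K) where

    private
      e∈K : e ∈ K
      e∈K = proj₁ K-subgroup
      ∙-closed : ∀ {x y} → x ∈ K → y ∈ K → x ∙ y ∈ K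
      ∙-closed = proj₁ (proj₂ K-subgroup) _ _
      ⁻¹-closed : ∀ {x} → x ∈ K → x ⁻¹ ∈ K
      ⁻¹-closed = proj₂ (proj₂ K-subgroup) _

    Adj-isEquivalence : IsEquivalence (Adj G K)
    Adj-isEquivalence = record
      { refl  = λ {x} → subst (_∈ K) (sym (inverseʳ x)) e∈K
      ; sym   = λ {x} {y} y∙x⁻¹∈K → subst (_∈ K) (y∙x⁻¹⁻¹≡x∙y⁻¹ x y) (⁻¹-closed y∙x⁻¹∈K)
      ; trans = λ {x} {y} {z} y∙x⁻¹∈K z∙y⁻¹∈K →
          subst (_∈ K) (trans (assoc z (y ⁻¹) (y ∙ x ⁻¹)) (cong (z ∙_) (\\-leftDividesʳ y (x ⁻¹))))
                (∙-closed z∙y⁻¹∈K y∙x⁻¹∈K)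
      }
      where
      y∙x⁻¹⁻¹≡x∙y⁻¹ : ∀ x y → (y ∙ x ⁻¹) ⁻¹ ≡ x ∙ y ⁻¹
      y∙x⁻¹⁻¹≡x∙y⁻¹ x y = trans (⁻¹-anti-homo-∙ y (x ⁻¹)) (cong (_∙ y ⁻¹) (⁻¹-involutive x))

    -- The class of x is the right coset Kx, the preimage of K under right translation by x ⁻¹.
    lagrange : ∣ K ∣ ∣ order
    lagrange = subst (∣ K ∣ ∣_) (∣⊤∣≡n order)
      (∣class∣≡m⇒m∣∣p∣ Adj-isEquivalence (λ x y → y ∙ x ⁻¹ ∈? K) ∣ K ∣ ⊤ (λ _ _ → ∈⊤)
                       (λ {x} _ → ∣preimage∣≡∣p∣ (rightTranslation (x ⁻¹)) K))

  module _ {H : Sub G} (H-normal : IsNormalSubgroup G H) where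

    private
      H-subgroup : IsSubgroup G H
      H-subgroup = proj₁ H-normal
      e∈H : e ∈ H
      e∈H = proj₁ H-subgroup
      ∙-closed : ∀ {x y} → x ∈ H → y ∈ H → x ∙ y ∈ H
      ∙-closed = proj₁ (proj₂ H-subgroup) _ _
      ⁻¹-closed : ∀ {x} → x ∈ H → x ⁻¹ ∈ H
      ⁻¹-closed = proj₂ (proj₂ H-subgroup) _
      conj-closed : ∀ g {x} → x ∈ H → g ∙ x ∙ g ⁻¹ ∈ H
      conj-closed g = proj₂ H-normal g _
      Adj-sym : ∀ {x y} → Adj G H x y → Adj G H y x
      Adj-sym = IsEquivalence.sym (Adj-isEquivalence H-subgroup)

    x∙y∈H⇒y∙x∈H : ∀ {x y} → x ∙ y ∈ H → y ∙ x ∈ H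
    x∙y∈H⇒y∙x∈H {x} {y} x∙y∈H = subst (_∈ H) x⁻¹∙[x∙y]∙x⁻¹⁻¹≡y∙x (conj-closed (x ⁻¹) x∙y∈H)
      where
      x⁻¹∙[x∙y]∙x⁻¹⁻¹≡y∙x : x ⁻¹ ∙ (x ∙ y) ∙ x ⁻¹ ⁻¹ ≡ y ∙ x
      x⁻¹∙[x∙y]∙x⁻¹⁻¹≡y∙x = cong₂ _∙_ (\\-leftDividesʳ x y) (⁻¹-involutive x)

    ∈H-Adj⇒∈H : ∀ {x y} → x ∈ H → Adj G H x y → y ∈ H
    ∈H-Adj⇒∈H {x} {y} x∈H y∙x⁻¹∈H = subst (_∈ H) (//-rightDividesˡ x y) (∙-closed y∙x⁻¹∈H x∈H)

    Adj-⁻¹ : ∀ {x y} → Adj G H x y → Adj G H (x ⁻¹) (y ⁻¹)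
    Adj-⁻¹ {x} {y} x~y = x∙y∈H⇒y∙x∈H (subst (λ w → w ∙ y ⁻¹ ∈ H) (sym (⁻¹-involutive x)) (Adj-sym x~y))

    SelfInverseCosetsHaveInvolutions : Set
    SelfInverseCosetsHaveInvolutions =
      ∀ x → x ∉ H → x ⁻¹ ∙ x ⁻¹ ∈ H → ∃ λ y → Adj G H x y × y ⁻¹ ≡ y

    odd⇒selfInverseCosetsHaveInvolutions : Odd ∣ H ∣ → SelfInverseCosetsHaveInvolutions
    odd⇒selfInverseCosetsHaveInvolutions odd x _ x⁻¹∙x⁻¹∈H =
      let a , a∈H , fa≡a = odd⇒fixedPoint f-involutive H f-closed odd
      in a ∙ x , subst (_∈ H) (sym (//-rightDividesʳ x a)) a∈H , [a∙x]⁻¹≡a∙x fa≡a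
      where
      open ≡-Reasoning

      -- a ∙ x is an involution exactly when a is a fixed point of f
      f : Fin order → Fin order
      f a = x ⁻¹ ∙ (a ⁻¹ ∙ x ⁻¹)

      f-closed : ∀ {a} → a ∈ H → f a ∈ H
      f-closed {a} a∈H = x∙y∈H⇒y∙x∈H
        (subst (_∈ H) (sym (assoc (a ⁻¹) (x ⁻¹) (x ⁻¹))) (∙-closed (⁻¹-closed a∈H) x⁻¹∙x⁻¹∈H))

      f-involutive : ∀ a → f (f a) ≡ a
      f-involutive a = begin
        x ⁻¹ ∙ ((x ⁻¹ ∙ (a ⁻¹ ∙ x ⁻¹)) ⁻¹ ∙ x ⁻¹) ≡⟨ cong (λ w → x ⁻¹ ∙ (w ∙ x ⁻¹)) [fa]⁻¹≡x∙a∙x ⟩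
        x ⁻¹ ∙ (x ∙ a ∙ x ∙ x ⁻¹)                   ≡⟨ cong (x ⁻¹ ∙_) (//-rightDividesʳ x (x ∙ a)) ⟩
        x ⁻¹ ∙ (x ∙ a)                              ≡⟨ \\-leftDividesʳ x a ⟩
        a                                           ∎
        where
        [fa]⁻¹≡x∙a∙x : (x ⁻¹ ∙ (a ⁻¹ ∙ x ⁻¹)) ⁻¹ ≡ x ∙ a ∙ x
        [fa]⁻¹≡x∙a∙x = begin
          (x ⁻¹ ∙ (a ⁻¹ ∙ x ⁻¹)) ⁻¹        ≡⟨ ⁻¹-anti-homo-∙ (x ⁻¹) (a ⁻¹ ∙ x ⁻¹) ⟩
          (a ⁻¹ ∙ x ⁻¹) ⁻¹ ∙ x ⁻¹ ⁻¹       ≡⟨ cong₂ _∙_ (⁻¹-anti-homo-∙ (a ⁻¹) (x ⁻¹)) (⁻¹-involutive x) ⟩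
          x ⁻¹ ⁻¹ ∙ a ⁻¹ ⁻¹ ∙ x            ≡⟨ cong₂ (λ u v → u ∙ v ∙ x) (⁻¹-involutive x) (⁻¹-involutive a) ⟩
          x ∙ a ∙ x                        ∎

      [a∙x]⁻¹≡a∙x : ∀ {a} → f a ≡ a → (a ∙ x) ⁻¹ ≡ a ∙ x
      [a∙x]⁻¹≡a∙x {a} fa≡a = begin
        (a ∙ x) ⁻¹                 ≡⟨ ⁻¹-anti-homo-∙ a x ⟩
        x ⁻¹ ∙ a ⁻¹                ≡⟨ cong (x ⁻¹ ∙_) (//-rightDividesˡ x (a ⁻¹)) ⟨
        x ⁻¹ ∙ (a ⁻¹ ∙ x ⁻¹ ∙ x)   ≡⟨ assoc (x ⁻¹) (a ⁻¹ ∙ x ⁻¹) x ⟨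
        f a ∙ x                    ≡⟨ cong (_∙ x) fa≡a ⟩
        a ∙ x                      ∎

    rightCoset : Fin order → Sub G
    rightCoset g = preimage (_∙ g ⁻¹) H

    module _ {g : Fin order} (g∉H : g ∉ H) (g∙g∈H : g ∙ g ∈ H) where

      private
        u∙g⁻¹∈H⇒u∙g∈H : ∀ {u} → u ∙ g ⁻¹ ∈ H → u ∙ g ∈ H
        u∙g⁻¹∈H⇒u∙g∈H {u} u∙g⁻¹∈H = subst (_∈ H)
          (trans (sym (assoc (u ∙ g ⁻¹) g g)) (cong (_∙ g) (//-rightDividesˡ g u)))
          (∙-closed u∙g⁻¹∈H g∙g∈H)

        ∈Hg⁺ : ∀ {u} → u ∙ g ⁻¹ ∈ H → u ∈ rightCoset g
        ∈Hg⁺ = ∈-subsetOf⁺ (λ z → z ∙ g ⁻¹ ∈? H)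

        ∈Hg⁻ : ∀ {u} → u ∈ rightCoset g → u ∙ g ⁻¹ ∈ H
        ∈Hg⁻ = ∈-subsetOf⁻ (λ z → z ∙ g ⁻¹ ∈? H)

        ∈H∪Hg⁻ : ∀ {u} → u ∈ H ∪ rightCoset g → u ∈ H ⊎ u ∙ g ⁻¹ ∈ H
        ∈H∪Hg⁻ u∈ = map₂ ∈Hg⁻ (x∈p∪q⁻ H (rightCoset g) u∈)

        ∈H∪Hg⁺ : ∀ {u} → u ∈ H ⊎ u ∙ g ⁻¹ ∈ H → u ∈ H ∪ rightCoset g
        ∈H∪Hg⁺ = x∈p∪q⁺ ∘ map₂ ∈Hg⁺

      H∪Hg-subgroup : IsSubgroup G (H ∪ rightCoset g)
      H∪Hg-subgroup = ∈H∪Hg⁺ (inj₁ e∈H)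
                    , (λ u v u∈ v∈ → ∈H∪Hg⁺ (mul (∈H∪Hg⁻ u∈) (∈H∪Hg⁻ v∈)))
                    , (λ u u∈ → ∈H∪Hg⁺ (inv (∈H∪Hg⁻ u∈)))
        where
        mul : ∀ {u v} → u ∈ H ⊎ u ∙ g ⁻¹ ∈ H → v ∈ H ⊎ v ∙ g ⁻¹ ∈ H → u ∙ v ∈ H ⊎ u ∙ v ∙ g ⁻¹ ∈ H
        mul (inj₁ u∈H) (inj₁ v∈H) = inj₁ (∙-closed u∈H v∈H)
        mul {u} {v} (inj₁ u∈H) (inj₂ v∙g⁻¹∈H) =
          inj₂ (subst (_∈ H) (sym (assoc u v (g ⁻¹))) (∙-closed u∈H v∙g⁻¹∈H))
        mul {u} {v} (inj₂ u∙g⁻¹∈H) (inj₁ v∈H) =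
          inj₂ (x∙y∈H⇒y∙x∈H (subst (_∈ H) (assoc (g ⁻¹) u v) (∙-closed (x∙y∈H⇒y∙x∈H u∙g⁻¹∈H) v∈H)))
        mul {u} {v} (inj₂ u∙g⁻¹∈H) (inj₂ v∙g⁻¹∈H) =
          inj₁ (subst (_∈ H) (trans (assoc u g (g ⁻¹ ∙ v)) (cong (u ∙_) (\\-leftDividesˡ g v)))
                  (∙-closed (u∙g⁻¹∈H⇒u∙g∈H u∙g⁻¹∈H) (x∙y∈H⇒y∙x∈H v∙g⁻¹∈H)))
        inv : ∀ {u} → u ∈ H ⊎ u ∙ g ⁻¹ ∈ H → u ⁻¹ ∈ H ⊎ u ⁻¹ ∙ g ⁻¹ ∈ H
        inv (inj₁ u∈H)        = inj₁ (⁻¹-closed u∈H)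
        inv {u} (inj₂ u∙g⁻¹∈H) =
          inj₂ (subst (_∈ H) (⁻¹-anti-homo-∙ g u) (⁻¹-closed (x∙y∈H⇒y∙x∈H (u∙g⁻¹∈H⇒u∙g∈H u∙g⁻¹∈H))))

      ∣H∪Hg∣≡2*∣H∣ : ∣ H ∪ rightCoset g ∣ ≡ 2 * ∣ H ∣
      ∣H∪Hg∣≡2*∣H∣ = begin
        ∣ H ∪ rightCoset g ∣                                  ≡⟨ ∣p∣≡∣p∩q∣+∣p─q∣ (H ∪ rightCoset g) H ⟩
        ∣ (H ∪ rightCoset g) ∩ H ∣ + ∣ H ∪ rightCoset g ─ H ∣  ≡⟨ cong₂ (λ p q → ∣ p ∣ + ∣ q ∣) (q⊆p⇒p∩q≡q (p⊆p∪q {p = H} (rightCoset g))) H∪Hg─H≡Hg ⟩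
        ∣ H ∣ + ∣ rightCoset g ∣                              ≡⟨ cong (∣ H ∣ +_) (∣preimage∣≡∣p∣ (rightTranslation (g ⁻¹)) H) ⟩
        ∣ H ∣ + ∣ H ∣                                         ≡⟨ cong (∣ H ∣ +_) (+-identityʳ ∣ H ∣) ⟨
        2 * ∣ H ∣                                             ∎
        where
        open ≡-Reasoning
        H∪Hg─H≡Hg : H ∪ rightCoset g ─ H ≡ rightCoset g
        H∪Hg─H≡Hg = ⊆-antisym
          (λ u∈ → [ (λ u∈H → contradiction u∈H (x∈p─q⇒x∉q _ H u∈)) , ∈Hg⁺ ]′ (∈H∪Hg⁻ (p─q⊆p _ H u∈)))
          (λ u∈Hg → x∈p∧x∉q⇒x∈p─q (∈H∪Hg⁺ (inj₂ (∈Hg⁻ u∈Hg)))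
                      (λ u∈H → g∉H (∈H-Adj⇒∈H u∈H (Adj-sym (∈Hg⁻ u∈Hg)))))

    oddIndex⇒selfInverseCosetsHaveInvolutions : ∀ {k} → k * ∣ H ∣ ≡ order → Odd k →
                                                SelfInverseCosetsHaveInvolutions
    oddIndex⇒selfInverseCosetsHaveInvolutions {k} index odd x x∉H x⁻¹∙x⁻¹∈H = contradiction 2∣k odd
      where
      x⁻¹∉H : x ⁻¹ ∉ H
      x⁻¹∉H = x∉H ∘ subst (_∈ H) (⁻¹-involutive x) ∘ ⁻¹-closed
      2*∣H∣∣k*∣H∣ : 2 * ∣ H ∣ ∣ k * ∣ H ∣
      2*∣H∣∣k*∣H∣ = subst₂ _∣_ (∣H∪Hg∣≡2*∣H∣ x⁻¹∉H x⁻¹∙x⁻¹∈H) (sym index) (lagrange (H∪Hg-subgroup x⁻¹∉H x⁻¹∙x⁻¹∈H))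
      2∣k : 2 ∣ k
      2∣k = *-cancelʳ-∣ ∣ H ∣ {{>-nonZero (subst (0 <_) (sym (x∈p⇒∣p∣≡1+∣p-x∣ e∈H)) (s≤s z≤n))}}
              2*∣H∣∣k*∣H∣

    even⇒involution : Even ∣ H ∣ → ∃ λ c → c ∈ H × c ≢ e × c ⁻¹ ≡ c
    even⇒involution even =
      let c , c∈H-e , c⁻¹≡c = odd⇒fixedPoint ⁻¹-involutive (H - e) (proj₂ H-e-isConnectionSet _) (even-suc⇒odd ∣H∣-even)
      in c , p─q⊆p H ⁅ e ⁆ c∈H-e , x∉⁅y⁆⇒x≢y (x∈p─q⇒x∉q H ⁅ e ⁆ c∈H-e) , c⁻¹≡c
      where
      H-e-isConnectionSet : IsConnectionSet G (H - e)
      H-e-isConnectionSet = inverseClosed⇒isConnectionSet ⁻¹-closed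
      ∣H∣-even : Even (ℕ.suc ∣ H - e ∣)
      ∣H∣-even = subst Even (x∈p⇒∣p∣≡1+∣p-x∣ e∈H) even

    -- IsTotalPerfectCodeIn G H T says that T meets every right coset Hx exactly once.
    symmetricCosetTransversal : ∀ {c} → c ∈ H → c ⁻¹ ≡ c → SelfInverseCosetsHaveInvolutions →
      ∃ λ T → (∀ {t} → t ∈ T → t ⁻¹ ∈ T) × c ∈ T × (∀ {t} → t ∈ T → t ∈ H → t ≡ c) × IsTotalPerfectCodeIn G H T
    symmetricCosetTransversal {c} c∈H c⁻¹≡c involutions =
      T , ι-closed , c∈T , ∈T∩H⇒≡c ,
      λ x → meets x , λ t t′ t∈T x~t t′∈T x~t′ → unique t∈T t′∈T (Adj-trans (Adj-sym x~t) x~t′)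
      where
      Adj-trans : ∀ {x y z} → Adj G H x y → Adj G H y z → Adj G H x z
      Adj-trans = IsEquivalence.trans (Adj-isEquivalence H-subgroup)

      fixedPoints : ∀ x → x ⁻¹ ∙ x ⁻¹ ∈ H → ∃ λ y → Adj G H x y × (y ∈ H → y ≡ c) × y ⁻¹ ≡ y
      fixedPoints x stable with x ∈? H
      ... | yes x∈H = c , ∙-closed c∈H (⁻¹-closed x∈H) , (λ _ → refl) , c⁻¹≡c
      ... | no  x∉H = let y , x~y , y⁻¹≡y = involutions x x∉H stable
                      in y , x~y , (λ y∈H → contradiction (∈H-Adj⇒∈H y∈H (Adj-sym x~y)) x∉H) , y⁻¹≡y

      open SymmetricTransversal (symmetricTransversal (Adj-isEquivalence H-subgroup) (λ x y → y ∙ x ⁻¹ ∈? H)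
                                  ⁻¹-involutive Adj-⁻¹ (λ z → (z ∈? H) →-dec (z ≟ c)) fixedPoints)

      ∈T∩H⇒≡c : ∀ {t} → t ∈ T → t ∈ H → t ≡ c
      ∈T∩H⇒≡c t∈T t∈H = admissible t∈T (∙-closed (⁻¹-closed t∈H) (⁻¹-closed t∈H)) t∈H

      c∈T : c ∈ T
      c∈T = let t , t∈T , c~t = meets c in subst (_∈ T) (∈T∩H⇒≡c t∈T (∈H-Adj⇒∈H c∈H c~t)) t∈T

    perfectCode : SelfInverseCosetsHaveInvolutions → IsPerfectCode G H
    perfectCode involutions =
      let T , T-closed , e∈T , _ , H-code = symmetricCosetTransversal e∈H ε⁻¹≈ε involutions
      in T - e , inverseClosed⇒isConnectionSet T-closed
               , totalPerfectCode⇒perfectCode e∈T (totalPerfectCode-swap H-code)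

    totalPerfectCode : (∃ λ c → c ∈ H × c ≢ e × c ⁻¹ ≡ c) → SelfInverseCosetsHaveInvolutions →
                       IsTotalPerfectCode G H
    totalPerfectCode (c , c∈H , c≢e , c⁻¹≡c) involutions =
      let T , T-closed , _ , ∈T∩H⇒≡c , H-code = symmetricCosetTransversal c∈H c⁻¹≡c involutions
      in T , ((λ e∈T → c≢e (sym (∈T∩H⇒≡c e∈T e∈H))) , λ _ → T-closed) , totalPerfectCode-swap H-code

corollary2p3 : (G : FiniteGroup) (H : Sub G) (k : ℕ) →
    IsNormalSubgroup G H → QuotientOrder G H k →
    ((Odd ∣ H ∣ ⊎ Odd k) → IsPerfectCode G H)
    × ((Even ∣ H ∣ × Odd k) → IsTotalPerfectCode G H)
corollary2p3 G H k H-normal index =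
    (λ odd → perfectCode G H-normal ([ odd⇒selfInverseCosetsHaveInvolutions G H-normal
                                     , oddIndex⇒selfInverseCosetsHaveInvolutions G H-normal index ]′ odd))
  , (λ (even , oddIndex) → totalPerfectCode G H-normal (even⇒involution G H-normal even)
                             (oddIndex⇒selfInverseCosetsHaveInvolutions G H-normal index oddIndex))
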